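{- Let $F$ be a DeMorgan circuit computing a Boolean function $f:\{0,1\}^n\to\{0,1\}$, and let $F^d$ be its dual circuit. The following assertions are equivalent: (1) $F$ is hazard-free; (2) neither $F$ nor $F^d$ has a $0$-hazard; (3) neither $F$ nor $F^d$ has a $1$-hazard; (4) $F$ produces (as terms of its formal DNF) all prime implicants of $f$ and produces (as clauses of its formal CNF) all prime implicates of $f$.
   Context: A DeMorgan circuit on variables $x_1,\dots,x_n$ is a circuit with fan-in-2 AND and OR gates whose inputs are the constants $0,1$, the variables $x_i$ and their negations $\bar x_i$. A literal is $x_i^1=x_i$ or $x_i^0=\bar x_i$; a term is an AND of literals, a clause an OR of literals. A zero-term is a term containing some $x_i$ together with $\bar x_i$; a one-clause is a clause containing some $x_i$ together with $\bar x_i$. Produced terms: at an input gate the produced term is the literal/constant itself; at an OR gate the set of produced terms is the union of the sets at its two inputs; at an AND gate it consists of all $t_1\land t_2$ with $t_1,t_2$ produced at the two inputs. Produced clauses are defined dually (union at AND gates, all $c_1\lor c_2$ at OR gates). The annihilation laws $x\bar x=0$, $x\lor\bar x=1$ are never applied, so zero-terms and one-clauses may be produced. The formal DNF of $F$ is the OR of terms produced at the output; the formal CNF is the AND of produced clauses. An implicant of $f$ is a term that is not a zero-term and satisfies $t\le f$; it is prime if no proper subterm is an implicant. An implicate is a clause that is not a one-clause with $f\le c$; prime if no proper subclause is an implicate. Ternary logic: on $\{0,\mathfrak u,1\}$ (identify $\mathfrak u=1/2$) AND is $\min$, OR is $\max$, NOT is $x\mapsto 1-x$; a DeMorgan circuit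 thereby computes a function $\{0,\mathfrak u,1\}^n\to\{0,\mathfrak u,1\}$. A resolution of $\alpha\in\{0,\mathfrak u,1\}^n$ is a vector in $\{0,1\}^n$ obtained by replacing each $\mathfrak u$ by $0$ or $1$; $S_\alpha$ is the set of resolutions. $F$ has an $\epsilon$-hazard ($\epsilon\in\{0,1\}$) at $\alpha$ if $F(a)=\epsilon$ for all $a\in S_\alpha$ but $F(\alpha)=\mathfrak u$; $F$ is hazard-free if it has no hazard at any $\alpha$. The dual circuit $F^d$ is obtained by exchanging AND and OR gates and exchanging input constants $0$ and $1$ (literals unchanged). -}

module Defs where

open import Data.Bool using (Bool; true; false; not; _∧_; _∨_; if_then_else_)
open import Data.Nat using (ℕ)
open import Data.Fin using (Fin)
open import Data.List using (List; []; _∷_; _++_; map; concatMap)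
open import Data.List.Membership.Propositional using (_∈_)
open import Data.Product using (Σ; _×_; _,_; ∃)
open import Data.Sum using (_⊎_)
open import Relation.Nullary using (¬_)
open import Relation.Binary.PropositionalEquality using (_≡_)
open import Function.Bundles using (_⇔_)

data Circuit (n : ℕ) : Set where
  const : Bool → Circuit n
  lit   : Fin n → Bool → Circuit n
  and   : Circuit n → Circuit n → Circuit n
  or    : Circuit n → Circuit n → Circuit n

BInput : ℕ → Set
BInput n = Fin n → Bool

litB : Bool → Bool → Bool
litB b v = if b then v else not v

evalB : ∀ {n} → Circuit n → BInput n → Bool
evalB (const c) a = c
evalB (lit i b) a = litB b (a i)
evalB (and F G) a = evalB F a ∧ evalB G a
evalB (or F G)  a = evalB F a ∨ evalB G a

-- Ternary logic {0, u, 1} with 0 < u < 1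

data T : Set where
  𝟘 𝔲 𝟙 : T

minT : T → T → T
minT 𝟘 _ = 𝟘
minT _ 𝟘 = 𝟘
minT 𝟙 y = y
minT 𝔲 𝟙 = 𝔲
minT 𝔲 𝔲 = 𝔲

maxT : T → T → T
maxT 𝟙 _ = 𝟙
maxT _ 𝟙 = 𝟙
maxT 𝟘 y = y
maxT 𝔲 𝟘 = 𝔲
maxT 𝔲 𝔲 = 𝔲

negT : T → T
negT 𝟘 = 𝟙
negT 𝔲 = 𝔲
negT 𝟙 = 𝟘

fromBool : Bool → T
fromBool false = 𝟘
fromBool true  = 𝟙

litT : Bool → T → T
litT b v = if b then v else negT v

TInput : ℕ → Set
TInput n = Fin n → T

evalT : ∀ {n} → Circuit n → TInput n → T
evalT (const c) α = fromBool c
evalT (lit i b) α = litT b (α i)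
evalT (and F G) α = minT (evalT F α) (evalT G α)
evalT (or F G)  α = maxT (evalT F α) (evalT G α)

IsResolution : ∀ {n} → TInput n → BInput n → Set
IsResolution α a = ∀ i → (α i ≡ 𝔲) ⊎ (α i ≡ fromBool (a i))

HasHazardAt : ∀ {n} → Circuit n → Bool → TInput n → Set
HasHazardAt F ε α =
  (∀ a → IsResolution α a → evalB F a ≡ ε) × (evalT F α ≡ 𝔲)

HasHazard : ∀ {n} → Circuit n → Bool → Set
HasHazard {n} F ε = Σ (TInput n) (HasHazardAt F ε)

HazardFree : ∀ {n} → Circuit n → Set
HazardFree F = ∀ ε α → ¬ HasHazardAt F ε α

dual : ∀ {n} → Circuit n → Circuit n
dual (const c) = const (not c)
dual (lit i b) = lit i b
dual (and F G) = or (dual F) (dual G)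
dual (or F G)  = and (dual F) (dual G)

-- Terms and clauses, as lists of literals (read as sets of literals)

Literal : ℕ → Set
Literal n = Fin n × Bool

Term : ℕ → Set
Term n = List (Literal n)

Clause : ℕ → Set
Clause n = List (Literal n)

pairwise : ∀ {n} → List (List (Literal n)) → List (List (Literal n)) → List (List (Literal n))
pairwise xs ys = concatMap (λ s → map (λ t → s ++ t) ys) xs

terms : ∀ {n} → Circuit n → List (Term n)
terms (const false) = []
terms (const true)  = [] ∷ []
terms (lit i b)     = ((i , b) ∷ []) ∷ []
terms (or F G)      = terms F ++ terms G
terms (and F G)     = pairwise (terms F) (terms G)

clauses : ∀ {n} → Circuit n → List (Clause n)
clauses (const true)  = []
clauses (const false) = [] ∷ []
clauses (lit i b)     = ((i , b) ∷ []) ∷ []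
clauses (and F G)     = clauses F ++ clauses G
clauses (or F G)      = pairwise (clauses F) (clauses G)

_⊆L_ : ∀ {n} → List (Literal n) → List (Literal n) → Set
s ⊆L t = ∀ {l} → l ∈ s → l ∈ t

_≈L_ : ∀ {n} → List (Literal n) → List (Literal n) → Set
s ≈L t = (s ⊆L t) × (t ⊆L s)

ProducesTerm : ∀ {n} → Circuit n → Term n → Set
ProducesTerm F t = ∃ λ p → (p ∈ terms F) × (p ≈L t)

ProducesClause : ∀ {n} → Circuit n → Clause n → Set
ProducesClause F c = ∃ λ p → (p ∈ clauses F) × (p ≈L c)

Contradictory : ∀ {n} → List (Literal n) → Set
Contradictory {n} s = ∃ λ (i : Fin n) → ((i , true) ∈ s) × ((i , false) ∈ s)

SatLit : ∀ {n} → BInput n → Literal n → Set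
SatLit a (i , b) = a i ≡ b

TermTrue : ∀ {n} → Term n → BInput n → Set
TermTrue t a = ∀ {l} → l ∈ t → SatLit a l

ClauseTrue : ∀ {n} → Clause n → BInput n → Set
ClauseTrue c a = ∃ λ l → (l ∈ c) × SatLit a l

BoolFun : ℕ → Set
BoolFun n = BInput n → Bool

IsImplicant : ∀ {n} → BoolFun n → Term n → Set
IsImplicant f t = ¬ Contradictory t × (∀ a → TermTrue t a → f a ≡ true)

IsPrimeImplicant : ∀ {n} → BoolFun n → Term n → Set
IsPrimeImplicant f t =
  IsImplicant f t × (∀ t′ → t′ ⊆L t → ¬ (t ⊆L t′) → ¬ IsImplicant f t′)

IsImplicate : ∀ {n} → BoolFun n → Clause n → Set
IsImplicate f c = ¬ Contradictory c × (∀ a → f a ≡ true → ClauseTrue c a)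

IsPrimeImplicate : ∀ {n} → BoolFun n → Clause n → Set
IsPrimeImplicate f c =
  IsImplicate f c × (∀ c′ → c′ ⊆L c → ¬ (c ⊆L c′) → ¬ IsImplicate f c′)

-- A term t determines the ternary input α_t = subcube t fixing exactly the variables of t.  In Kleene's logic a
-- circuit outputs 1 at α iff one of its produced terms is 1 at α, and a determined output agrees with
-- the Boolean output on every resolution.  So if F has no 1-hazard and t is a prime implicant,
-- F(α_t) = 1, which yields a produced term p ⊆ t; p is an implicant, hence p = t by primality.
-- Conversely, a 1-hazard at α makes the literals set to 1 by α an implicant; a prime implicant inside
-- it, if produced, would force F(α) = 1.  Duality (F^d(¬α) = ¬F(α), the clauses of F are the terms of
-- F^d, the prime implicates of f are the prime implicants of f^d) turns ε-hazards of F into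
-- ¬ε-hazards of F^d and transfers the statement to 0-hazards and prime implicates.

module Submission where

open import Defs
open import Data.Bool using (Bool; true; false; not; _∧_; _∨_)
import Data.Bool as Bool
open import Data.Bool.Properties using (∨-∧-booleanAlgebra; not-involutive; ¬-not; not-¬; ∧-zeroʳ; ∨-zeroʳ)
open import Algebra.Lattice.Properties.BooleanAlgebra ∨-∧-booleanAlgebra using (deMorgan₁; deMorgan₂)
open import Data.Fin using (Fin)
import Data.Fin as Fin
open import Data.List using (List; []; _∷_; _++_; map; filter; length; allFin; cartesianProduct)
open import Data.List.Membership.Propositional using (_∈_; _∉_; find; lose)
open import Data.List.Membership.Propositional.Properties
  using (∈-++⁺ˡ; ∈-++⁺ʳ; ∈-++⁻; ∈-map⁺; ∈-map⁻; ∈-concat⁺′; ∈-concat⁻′; ∈-filter⁺; ∈-filter⁻;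
         ∈-allFin; ∈-cartesianProduct⁺)
import Data.List.Membership.DecPropositional as DecMembership
open import Data.List.Properties using (filter-notAll)
open import Data.List.Relation.Unary.All using (all?; lookup; tabulate)
open import Data.List.Relation.Unary.All.Properties using (¬All⇒Any¬)
open import Data.List.Relation.Unary.Any using (here; there; any?)
open import Data.Nat using (ℕ; _<_)
open import Data.Nat.Induction using (<-wellFounded)
open import Data.Product using (_×_; _,_; ∃; proj₁; proj₂)
open import Data.Product.Function.NonDependent.Propositional using (_×-⇔_)
open import Data.Product.Properties using (≡-dec)
open import Data.Sum using (_⊎_; inj₁; inj₂; [_,_])
open import Function using (_∘_)
open import Function.Bundles using (Equivalence; _⇔_; mk⇔)
open import Function.Construct.Composition using (_⇔-∘_)
open import Function.Construct.Identity using (⇔-id)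
open import Function.Construct.Symmetry using (⇔-sym)
open import Function.Properties.Inverse using (↔⇒⇔)
open import Function.Related.TypeIsomorphisms using (×-comm; ¬-cong-⇔)
open import Induction.WellFounded using (Acc; acc)
open import Relation.Binary.Definitions using (DecidableEquality)
open import Relation.Binary.PropositionalEquality
  using (_≡_; _≢_; refl; sym; trans; cong; cong₂; subst; subst₂)
open import Relation.Nullary using (¬_; Dec; yes; no; contradiction)
open import Relation.Nullary.Decidable using (map′; ¬?; decidable-stable)

private
  variable
    n : ℕ
    x y : T
    b ε : Bool
    α : TInput n
    a : BInput n
    s t p c : Term n

fromBool-injective : fromBool b ≡ fromBool ε → b ≡ ε
fromBool-injective {false} {false} _ = refl
fromBool-injective {true}  {true}  _ = refl

fromBool≢𝔲 : fromBool b ≢ 𝔲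
fromBool≢𝔲 {false} ()
fromBool≢𝔲 {true}  ()

fromBool-not : fromBool (not b) ≡ negT (fromBool b)
fromBool-not {false} = refl
fromBool-not {true}  = refl

negT-≡𝔲 : negT x ≡ 𝔲 → x ≡ 𝔲
negT-≡𝔲 {𝔲} _ = refl

negT-≡fromBool : negT x ≡ fromBool b → x ≡ fromBool (not b)
negT-≡fromBool {𝟘} {true}  _ = refl
negT-≡fromBool {𝟙} {false} _ = refl

negT-minT : ∀ x y → negT (minT x y) ≡ maxT (negT x) (negT y)
negT-minT 𝟘 y = refl
negT-minT 𝔲 𝟘 = refl
negT-minT 𝔲 𝔲 = refl
negT-minT 𝔲 𝟙 = refl
negT-minT 𝟙 𝟘 = refl
negT-minT 𝟙 𝔲 = refl
negT-minT 𝟙 𝟙 = refl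

negT-maxT : ∀ x y → negT (maxT x y) ≡ minT (negT x) (negT y)
negT-maxT 𝟙 y = refl
negT-maxT 𝔲 𝟘 = refl
negT-maxT 𝔲 𝔲 = refl
negT-maxT 𝔲 𝟙 = refl
negT-maxT 𝟘 𝟘 = refl
negT-maxT 𝟘 𝔲 = refl
negT-maxT 𝟘 𝟙 = refl

minT-≡𝟙 : minT x y ≡ 𝟙 → x ≡ 𝟙 × y ≡ 𝟙
minT-≡𝟙 {𝟙} {𝟙} _ = refl , refl
minT-≡𝟙 {𝔲} {𝟙} ()

minT-≡𝟘 : minT x y ≡ 𝟘 → x ≡ 𝟘 ⊎ y ≡ 𝟘
minT-≡𝟘 {𝟘}         _ = inj₁ refl
minT-≡𝟘 {𝔲} {𝟘}     _ = inj₂ refl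
minT-≡𝟘 {𝟙} {𝟘}     _ = inj₂ refl

maxT-≡𝟙 : maxT x y ≡ 𝟙 → x ≡ 𝟙 ⊎ y ≡ 𝟙
maxT-≡𝟙 {𝟙}     _ = inj₁ refl
maxT-≡𝟙 {𝔲} {𝟙} _ = inj₂ refl
maxT-≡𝟙 {𝟘} {𝟙} _ = inj₂ refl

maxT-≡𝟘 : maxT x y ≡ 𝟘 → x ≡ 𝟘 × y ≡ 𝟘
maxT-≡𝟘 {𝟘} {𝟘} _ = refl , refl
maxT-≡𝟘 {𝔲} {𝟘} ()

maxT-𝟙ʳ : ∀ x → maxT x 𝟙 ≡ 𝟙
maxT-𝟙ʳ 𝟘 = refl
maxT-𝟙ʳ 𝔲 = refl
maxT-𝟙ʳ 𝟙 = refl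

litT-negT : ∀ b x → litT b (negT x) ≡ negT (litT b x)
litT-negT true  x = refl
litT-negT false x = refl

litT-≡𝟙 : litT b x ≡ 𝟙 → x ≡ fromBool b
litT-≡𝟙 {true}  e = e
litT-≡𝟙 {false} e = negT-≡fromBool e

litT-fromBool : ∀ b → litT b (fromBool b) ≡ 𝟙
litT-fromBool true  = refl
litT-fromBool false = refl

litB-not : ∀ b v → litB b (not v) ≡ not (litB b v)
litB-not true  v = refl
litB-not false v = refl

is𝟙? : (x : T) → Dec (x ≡ 𝟙)
is𝟙? 𝟘 = no λ ()
is𝟙? 𝔲 = no λ ()
is𝟙? 𝟙 = yes refl

resolveT : T → Bool
resolveT 𝟙 = true
resolveT _ = false

resolveT-resolves : ∀ x → x ≡ 𝔲 ⊎ x ≡ fromBool (resolveT x)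
resolveT-resolves 𝟘 = inj₂ refl
resolveT-resolves 𝔲 = inj₁ refl
resolveT-resolves 𝟙 = inj₂ refl

resolution-exists : (α : TInput n) → ∃ (IsResolution α)
resolution-exists α = resolveT ∘ α , resolveT-resolves ∘ α

fromBool-resolution : IsResolution (fromBool ∘ a) a
fromBool-resolution i = inj₂ refl

resolution-agrees : IsResolution α a → ∀ {i} → α i ≡ fromBool b → a i ≡ b
resolution-agrees r {i} e with r i
... | inj₁ α≡𝔲 = contradiction (trans (sym e) α≡𝔲) fromBool≢𝔲
... | inj₂ α≡a = sym (fromBool-injective (trans (sym e) α≡a))

negT-resolution : IsResolution (negT ∘ α) a → IsResolution α (not ∘ a)
negT-resolution r i with r i
... | inj₁ e = inj₁ (negT-≡𝔲 e)
... | inj₂ e = inj₂ (negT-≡fromBool e)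

evalT-resolution : (F : Circuit n) → IsResolution α a → evalT F α ≡ fromBool b → evalB F a ≡ b
evalT-resolution (const c)     r e = fromBool-injective e
evalT-resolution (lit i true)  r e = resolution-agrees r e
evalT-resolution (lit i false) r e = trans (cong not (resolution-agrees r (negT-≡fromBool e))) (not-involutive _)
evalT-resolution {b = true} (and F G) r e =
  let e₁ , e₂ = minT-≡𝟙 e in cong₂ _∧_ (evalT-resolution F r e₁) (evalT-resolution G r e₂)
evalT-resolution {a = a} {b = false} (and F G) r e with minT-≡𝟘 e
... | inj₁ e₁ = cong (_∧ evalB G a) (evalT-resolution F r e₁)
... | inj₂ e₂ = trans (cong (evalB F a ∧_) (evalT-resolution G r e₂)) (∧-zeroʳ _)
evalT-resolution {b = false} (or F G) r e =
  let e₁ , e₂ = maxT-≡𝟘 e in cong₂ _∨_ (evalT-resolution F r e₁) (evalT-resolution G r e₂)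
evalT-resolution {a = a} {b = true} (or F G) r e with maxT-≡𝟙 e
... | inj₁ e₁ = cong (_∨ evalB G a) (evalT-resolution F r e₁)
... | inj₂ e₂ = trans (cong (evalB F a ∨_) (evalT-resolution G r e₂)) (∨-zeroʳ _)

constant-on-resolutions⇒evalT : (F : Circuit n) → ¬ HasHazard F ε →
  (∀ a → IsResolution α a → evalB F a ≡ ε) → evalT F α ≡ fromBool ε
constant-on-resolutions⇒evalT {α = α} F no-hazard constant with resolveT-resolves (evalT F α)
... | inj₁ e = contradiction (α , constant , e) no-hazard
... | inj₂ e =
  let a , r = resolution-exists α
  in subst (λ b → evalT F α ≡ fromBool b) (trans (sym (evalT-resolution F r e)) (constant a r)) e

dual-involutive : (F : Circuit n) → dual (dual F) ≡ F
dual-involutive (const c) = cong const (not-involutive c)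
dual-involutive (lit i b) = refl
dual-involutive (and F G) = cong₂ and (dual-involutive F) (dual-involutive G)
dual-involutive (or F G)  = cong₂ or (dual-involutive F) (dual-involutive G)

evalT-dual : (F : Circuit n) (α : TInput n) → evalT (dual F) (negT ∘ α) ≡ negT (evalT F α)
evalT-dual (const c) α = fromBool-not
evalT-dual (lit i b) α = litT-negT b (α i)
evalT-dual (and F G) α =
  trans (cong₂ maxT (evalT-dual F α) (evalT-dual G α)) (sym (negT-minT (evalT F α) (evalT G α)))
evalT-dual (or F G) α =
  trans (cong₂ minT (evalT-dual F α) (evalT-dual G α)) (sym (negT-maxT (evalT F α) (evalT G α)))

evalB-dual : (F : Circuit n) (a : BInput n) → evalB (dual F) a ≡ not (evalB F (not ∘ a))
evalB-dual (const c) a = refl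
evalB-dual (lit i b) a = trans (sym (not-involutive _)) (cong not (sym (litB-not b (a i))))
evalB-dual (and F G) a =
  trans (cong₂ _∨_ (evalB-dual F a) (evalB-dual G a)) (sym (deMorgan₁ (evalB F (not ∘ a)) (evalB G (not ∘ a))))
evalB-dual (or F G) a =
  trans (cong₂ _∧_ (evalB-dual F a) (evalB-dual G a)) (sym (deMorgan₂ (evalB F (not ∘ a)) (evalB G (not ∘ a))))

evalB-undual : (F : Circuit n) (a : BInput n) → evalB F a ≡ not (evalB (dual F) (not ∘ a))
evalB-undual F a = subst (λ G → evalB G a ≡ not (evalB (dual F) (not ∘ a))) (dual-involutive F) (evalB-dual (dual F) a)

hasHazardAt-dual : (F : Circuit n) → HasHazardAt F ε α → HasHazardAt (dual F) (not ε) (negT ∘ α)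
hasHazardAt-dual {α = α} F (constant , undetermined) =
    (λ a r → trans (evalB-dual F a) (cong not (constant (not ∘ a) (negT-resolution r))))
  , trans (evalT-dual F α) (cong negT undetermined)

hasHazard⇔hasHazard-dual : (F : Circuit n) → HasHazard F ε ⇔ HasHazard (dual F) (not ε)
hasHazard⇔hasHazard-dual {ε = ε} F = mk⇔
  (λ (α , h) → negT ∘ α , hasHazardAt-dual F h)
  (λ (α , h) → subst₂ HasHazard (dual-involutive F) (not-involutive ε) (negT ∘ α , hasHazardAt-dual (dual F) h))

∈-pairwise⁺ : {xs ys : List (Term n)} → s ∈ xs → t ∈ ys → s ++ t ∈ pairwise xs ys
∈-pairwise⁺ {s = s} {ys = ys} s∈ t∈ = ∈-concat⁺′ (∈-map⁺ (s ++_) t∈) (∈-map⁺ (λ s → map (s ++_) ys) s∈)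

∈-pairwise⁻ : (xs ys : List (Term n)) → p ∈ pairwise xs ys → ∃ λ s → ∃ λ t → s ∈ xs × t ∈ ys × p ≡ s ++ t
∈-pairwise⁻ xs ys p∈ with ∈-concat⁻′ (map (λ s → map (s ++_) ys) xs) p∈
... | _ , p∈zs , zs∈ with ∈-map⁻ (λ s → map (s ++_) ys) zs∈
... | s , s∈ , refl with ∈-map⁻ (s ++_) p∈zs
... | t , t∈ , refl = s , t , s∈ , t∈ , refl

clauses≡terms-dual : (F : Circuit n) → clauses F ≡ terms (dual F)
clauses≡terms-dual (const true)  = refl
clauses≡terms-dual (const false) = refl
clauses≡terms-dual (lit i b)     = refl
clauses≡terms-dual (and F G)     = cong₂ _++_ (clauses≡terms-dual F) (clauses≡terms-dual G)
clauses≡terms-dual (or F G)      = cong₂ pairwise (clauses≡terms-dual F) (clauses≡terms-dual G)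

evalLit : TInput n → Literal n → T
evalLit α (i , b) = litT b (α i)

TermOneAt : Term n → TInput n → Set
TermOneAt t α = ∀ {l} → l ∈ t → evalLit α l ≡ 𝟙

evalT≡𝟙⇒producedTermOne : (F : Circuit n) → evalT F α ≡ 𝟙 → ∃ λ p → p ∈ terms F × TermOneAt p α
evalT≡𝟙⇒producedTermOne (const true) e = [] , here refl , λ ()
evalT≡𝟙⇒producedTermOne (lit i b)    e = _ , here refl , λ { (here refl) → e }
evalT≡𝟙⇒producedTermOne (or F G) e with maxT-≡𝟙 e
... | inj₁ e₁ = let p , p∈ , one = evalT≡𝟙⇒producedTermOne F e₁ in p , ∈-++⁺ˡ p∈ , one
... | inj₂ e₂ = let p , p∈ , one = evalT≡𝟙⇒producedTermOne G e₂ in p , ∈-++⁺ʳ (terms F) p∈ , one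
evalT≡𝟙⇒producedTermOne (and F G) e =
  let e₁ , e₂ = minT-≡𝟙 e
      p , p∈ , p-one = evalT≡𝟙⇒producedTermOne F e₁
      q , q∈ , q-one = evalT≡𝟙⇒producedTermOne G e₂
  in p ++ q , ∈-pairwise⁺ p∈ q∈ , [ p-one , q-one ] ∘ ∈-++⁻ p

producedTermOne⇒evalT≡𝟙 : (F : Circuit n) → p ∈ terms F → TermOneAt p α → evalT F α ≡ 𝟙
producedTermOne⇒evalT≡𝟙 (const true) _ _ = refl
producedTermOne⇒evalT≡𝟙 (lit i b) (here refl) one = one (here refl)
producedTermOne⇒evalT≡𝟙 {α = α} (or F G) p∈ one with ∈-++⁻ (terms F) p∈
... | inj₁ p∈F rewrite producedTermOne⇒evalT≡𝟙 F p∈F one = refl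
... | inj₂ p∈G rewrite producedTermOne⇒evalT≡𝟙 G p∈G one = maxT-𝟙ʳ (evalT F α)
producedTermOne⇒evalT≡𝟙 (and F G) p∈ one with ∈-pairwise⁻ (terms F) (terms G) p∈
... | s , t , s∈ , t∈ , refl
  rewrite producedTermOne⇒evalT≡𝟙 F s∈ (one ∘ ∈-++⁺ˡ) | producedTermOne⇒evalT≡𝟙 G t∈ (one ∘ ∈-++⁺ʳ s) = refl

TermTrue⇒TermOneAt : TermTrue t a → TermOneAt t (fromBool ∘ a)
TermTrue⇒TermOneAt true-at {i , b} m rewrite true-at m = litT-fromBool b

producedTerm-implies : (F : Circuit n) → p ∈ terms F → TermTrue p a → evalB F a ≡ true
producedTerm-implies F p∈ true-at =
  evalT-resolution F fromBool-resolution (producedTermOne⇒evalT≡𝟙 F p∈ (TermTrue⇒TermOneAt true-at))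

_≟L_ : DecidableEquality (Literal n)
_≟L_ = ≡-dec Fin._≟_ Bool._≟_

_∈L?_ : (l : Literal n) (t : Term n) → Dec (l ∈ t)
_∈L?_ = DecMembership._∈?_ _≟L_

_⊆L?_ : (s t : Term n) → Dec (s ⊆L t)
s ⊆L? t = map′ lookup tabulate (all? (_∈L? t) s)

⊈⇒∃∉ : ¬ (s ⊆L t) → ∃ λ l → l ∈ s × l ∉ t
⊈⇒∃∉ {s = s} {t = t} s⊈t = find (¬All⇒Any¬ (_∈L? t) s (s⊈t ∘ lookup))

contradictory-⊆ : s ⊆L t → Contradictory s → Contradictory t
contradictory-⊆ s⊆t (i , pos , neg) = i , s⊆t pos , s⊆t neg

implicant-⊇ : {f : BoolFun n} → s ⊆L t → ¬ Contradictory t → IsImplicant f s → IsImplicant f t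
implicant-⊇ s⊆t consistent (_ , s⇒f) = consistent , λ a true-at → s⇒f a (true-at ∘ s⊆t)

remove : Literal n → Term n → Term n
remove l = filter (λ l′ → ¬? (l′ ≟L l))

remove-⊆ : ∀ {l} → remove l t ⊆L t
remove-⊆ {t = t} {l} = proj₁ ∘ ∈-filter⁻ (λ l′ → ¬? (l′ ≟L l)) {xs = t}

∈-remove⁺ : ∀ {l l′} → l′ ∈ t → l′ ≢ l → l′ ∈ remove l t
∈-remove⁺ {l = l} = ∈-filter⁺ (λ l′ → ¬? (l′ ≟L l))

length-remove-< : ∀ {l} → l ∈ t → length (remove l t) < length t
length-remove-< {t = t} {l} l∈t = filter-notAll (λ l′ → ¬? (l′ ≟L l)) t (lose l∈t (λ l≢l → l≢l refl))

-- Doubly negated because being an implicant is not decided; it is only used to derive a contradiction.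
implicant-contains-prime : {f : BoolFun n} → Acc _<_ (length s) → IsImplicant f s →
  ¬ (∀ p → IsPrimeImplicant f p → ¬ p ⊆L s)
implicant-contains-prime {s = s} {f = f} (acc smaller) s-implicant no-prime =
  no-prime s (s-implicant , minimal) (λ m → m)
  where
  minimal : ∀ t → t ⊆L s → ¬ s ⊆L t → ¬ IsImplicant f t
  minimal t t⊆s s⊈t t-implicant =
    let l , l∈s , l∉t = ⊈⇒∃∉ s⊈t
        t⊆s∖l : t ⊆L remove l s
        t⊆s∖l m = ∈-remove⁺ (t⊆s m) (λ { refl → l∉t m })
    in implicant-contains-prime (smaller (length-remove-< l∈s))
         (implicant-⊇ t⊆s∖l (proj₁ s-implicant ∘ contradictory-⊆ remove-⊆) t-implicant)
         (λ p p-prime p⊆s∖l → no-prime p p-prime (remove-⊆ ∘ p⊆s∖l))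

-- For consistent t, the resolutions of subcube t are exactly the points satisfying t.
subcube : Term n → TInput n
subcube t i with (i , true) ∈L? t | (i , false) ∈L? t
... | yes _ | _     = 𝟙
... | no _  | yes _ = 𝟘
... | no _  | no _  = 𝔲

subcube-≡fromBool⇒∈ : (t : Term n) (i : Fin n) → subcube t i ≡ fromBool b → (i , b) ∈ t
subcube-≡fromBool⇒∈ t i e with (i , true) ∈L? t | (i , false) ∈L? t
subcube-≡fromBool⇒∈ {b = true}  t i e  | yes pos | _       = pos
subcube-≡fromBool⇒∈ {b = false} t i () | yes _   | _
subcube-≡fromBool⇒∈ {b = true}  t i () | no _    | yes _
subcube-≡fromBool⇒∈ {b = false} t i e  | no _    | yes neg = neg
subcube-≡fromBool⇒∈ {b = true}  t i () | no _    | no _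
subcube-≡fromBool⇒∈ {b = false} t i () | no _    | no _

∈⇒subcube-≡fromBool : (t : Term n) → ¬ Contradictory t → ∀ {i} → (i , b) ∈ t → subcube t i ≡ fromBool b
∈⇒subcube-≡fromBool t consistent {i} m with (i , true) ∈L? t | (i , false) ∈L? t
∈⇒subcube-≡fromBool {b = true}  t consistent m | yes _   | _       = refl
∈⇒subcube-≡fromBool {b = false} t consistent m | yes pos | _       = contradiction (_ , pos , m) consistent
∈⇒subcube-≡fromBool {b = true}  t consistent m | no pos∉ | _       = contradiction m pos∉
∈⇒subcube-≡fromBool {b = false} t consistent m | no _    | yes _   = refl
∈⇒subcube-≡fromBool {b = false} t consistent m | no _    | no neg∉ = contradiction m neg∉

subcube-resolution⇒TermTrue : ¬ Contradictory t → IsResolution (subcube t) a → TermTrue t a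
subcube-resolution⇒TermTrue consistent r m = resolution-agrees r (∈⇒subcube-≡fromBool _ consistent m)

TermOneAt-subcube⇒⊆ : TermOneAt p (subcube t) → p ⊆L t
TermOneAt-subcube⇒⊆ {t = t} one {i , b} m = subcube-≡fromBool⇒∈ t i (litT-≡𝟙 (one m))

allLiterals : List (Literal n)
allLiterals {n} = cartesianProduct (allFin n) (true ∷ false ∷ [])

∈-allLiterals : (l : Literal n) → l ∈ allLiterals
∈-allLiterals (i , true)  = ∈-cartesianProduct⁺ (∈-allFin i) (here refl)
∈-allLiterals (i , false) = ∈-cartesianProduct⁺ (∈-allFin i) (there (here refl))

-- The largest term all of whose satisfying points are resolutions of α.
onesOf : TInput n → Term n
onesOf α = filter (is𝟙? ∘ evalLit α) allLiterals

∈-onesOf⁻ : ∀ {l} → l ∈ onesOf α → evalLit α l ≡ 𝟙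
∈-onesOf⁻ {α = α} = proj₂ ∘ ∈-filter⁻ (is𝟙? ∘ evalLit α) {xs = allLiterals}

∈-onesOf⁺ : ∀ {l} → evalLit α l ≡ 𝟙 → l ∈ onesOf α
∈-onesOf⁺ {α = α} {l} = ∈-filter⁺ (is𝟙? ∘ evalLit α) (∈-allLiterals l)

onesOf-consistent : ¬ Contradictory (onesOf α)
onesOf-consistent (i , pos , neg) with trans (sym (litT-≡𝟙 {b = true} (∈-onesOf⁻ pos))) (litT-≡𝟙 {b = false} (∈-onesOf⁻ neg))
... | ()

TermTrue-onesOf⇒resolution : TermTrue (onesOf α) a → IsResolution α a
TermTrue-onesOf⇒resolution {α = α} true-at i with resolveT-resolves (α i)
... | inj₁ e = inj₁ e
... | inj₂ e = inj₂ (trans e (cong fromBool (sym (true-at (∈-onesOf⁺ one)))))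
  where
  one : litT (resolveT (α i)) (α i) ≡ 𝟙
  one = trans (cong (litT (resolveT (α i))) e) (litT-fromBool (resolveT (α i)))

ProducesPrimeImplicants : Circuit n → Set
ProducesPrimeImplicants F = ∀ t → IsPrimeImplicant (evalB F) t → ProducesTerm F t

ProducesPrimeImplicates : Circuit n → Set
ProducesPrimeImplicates F = ∀ c → IsPrimeImplicate (evalB F) c → ProducesClause F c

no1Hazard⇒implicant-contains-produced : (F : Circuit n) → ¬ HasHazard F true →
  IsImplicant (evalB F) t → ∃ λ p → p ∈ terms F × p ⊆L t
no1Hazard⇒implicant-contains-produced F no-hazard (consistent , t⇒F) =
  let F-one = constant-on-resolutions⇒evalT F no-hazard
                (λ a r → t⇒F a (subcube-resolution⇒TermTrue consistent r))
      p , p∈ , p-one = evalT≡𝟙⇒producedTermOne F F-one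
  in p , p∈ , TermOneAt-subcube⇒⊆ p-one

no1Hazard⇒producesPrimeImplicants : (F : Circuit n) → ¬ HasHazard F true → ProducesPrimeImplicants F
no1Hazard⇒producesPrimeImplicants F no-hazard t (t-implicant@(consistent , _) , minimal) =
  let p , p∈ , p⊆t = no1Hazard⇒implicant-contains-produced F no-hazard t-implicant
      p-implicant = consistent ∘ contradictory-⊆ p⊆t , λ a → producedTerm-implies F p∈
  in p , p∈ , p⊆t , decidable-stable (t ⊆L? p) (λ t⊈p → minimal p p⊆t t⊈p p-implicant)

producesPrimeImplicants⇒no1Hazard : (F : Circuit n) → ProducesPrimeImplicants F → ¬ HasHazard F true
producesPrimeImplicants⇒no1Hazard F produces (α , F-true , F-undetermined) =
  implicant-contains-prime (<-wellFounded _) ones-implicant λ p p-prime p⊆ones →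
    let q , q∈ , q⊆p , _ = produces p p-prime
    in contradiction (trans (sym F-undetermined) (producedTermOne⇒evalT≡𝟙 F q∈ (∈-onesOf⁻ ∘ p⊆ones ∘ q⊆p)))
                     λ ()
  where
  ones-implicant : IsImplicant (evalB F) (onesOf α)
  ones-implicant = onesOf-consistent , λ a → F-true a ∘ TermTrue-onesOf⇒resolution

no1Hazard⇔producesPrimeImplicants : (F : Circuit n) → (¬ HasHazard F true) ⇔ ProducesPrimeImplicants F
no1Hazard⇔producesPrimeImplicants F =
  mk⇔ (no1Hazard⇒producesPrimeImplicants F) (producesPrimeImplicants⇒no1Hazard F)

SatLit⇒¬SatLit-not : ∀ l → SatLit a l → ¬ SatLit (not ∘ a) l
SatLit⇒¬SatLit-not (i , b) sat sat-not = not-¬ sat (trans (sym (not-involutive _)) (cong not sat-not))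

¬SatLit⇒SatLit-not : ∀ l → ¬ SatLit a l → SatLit (not ∘ a) l
¬SatLit⇒SatLit-not (i , b) unsat = trans (cong not (¬-not unsat)) (not-involutive b)

implicate⇒dual-implicant : {f g : BoolFun n} → (∀ a → g a ≡ not (f (not ∘ a))) →
  IsImplicate f c → IsImplicant g c
implicate⇒dual-implicant g≡fᵈ (consistent , f⇒c) = consistent , λ a true-at →
  trans (g≡fᵈ a) (cong not (¬-not λ f≡true →
    let l , l∈ , sat = f⇒c (not ∘ a) f≡true in SatLit⇒¬SatLit-not {a = a} l (true-at l∈) sat))

dual-implicant⇒implicate : {f g : BoolFun n} → (∀ a → f a ≡ not (g (not ∘ a))) →
  IsImplicant g c → IsImplicate f c
dual-implicant⇒implicate {c = c} f≡gᵈ (consistent , c⇒g) = consistent , true⇒c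
  where
  true⇒c : ∀ a → _ ≡ true → ClauseTrue c a
  true⇒c a f≡true with any? (λ (i , b) → a i Bool.≟ b) c
  ... | yes sat = find sat
  ... | no unsat = contradiction (trans (sym f≡true) (f≡gᵈ a))
      (not-¬ (sym (c⇒g (not ∘ a) λ {l} l∈ → ¬SatLit⇒SatLit-not {a = a} l (unsat ∘ lose l∈))))

primeImplicate⇔dual-primeImplicant : {f g : BoolFun n} →
  (∀ a → g a ≡ not (f (not ∘ a))) → (∀ a → f a ≡ not (g (not ∘ a))) →
  IsPrimeImplicate f c ⇔ IsPrimeImplicant g c
primeImplicate⇔dual-primeImplicant g≡fᵈ f≡gᵈ = mk⇔
  (λ (c-implicate , minimal) → implicate⇒dual-implicant g≡fᵈ c-implicate
    , λ c′ c′⊆c c⊈c′ → minimal c′ c′⊆c c⊈c′ ∘ dual-implicant⇒implicate f≡gᵈ)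
  (λ (c-implicant , minimal) → dual-implicant⇒implicate f≡gᵈ c-implicant
    , λ c′ c′⊆c c⊈c′ → minimal c′ c′⊆c c⊈c′ ∘ implicate⇒dual-implicant g≡fᵈ)

producesClause⇔producesTerm-dual : (F : Circuit n) → ProducesClause F c ⇔ ProducesTerm (dual F) c
producesClause⇔producesTerm-dual {c = c} F = mk⇔
  (subst (λ ps → ∃ λ p → p ∈ ps × p ≈L c) (clauses≡terms-dual F))
  (subst (λ ps → ∃ λ p → p ∈ ps × p ≈L c) (sym (clauses≡terms-dual F)))

producesPrimeImplicates⇔producesPrimeImplicants-dual : (F : Circuit n) →
  ProducesPrimeImplicates F ⇔ ProducesPrimeImplicants (dual F)
producesPrimeImplicates⇔producesPrimeImplicants-dual F = mk⇔
  (λ produces c → to (producesClause⇔producesTerm-dual F) ∘ produces c ∘ from prime)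
  (λ produces c → from (producesClause⇔producesTerm-dual F) ∘ produces c ∘ to prime)
  where
  open Equivalence
  prime : IsPrimeImplicate (evalB F) c ⇔ IsPrimeImplicant (evalB (dual F)) c
  prime = primeImplicate⇔dual-primeImplicant (evalB-dual F) (evalB-undual F)

hazardFree⇔no0Hazard×no1Hazard : (F : Circuit n) →
  HazardFree F ⇔ (¬ HasHazard F false × ¬ HasHazard F true)
hazardFree⇔no0Hazard×no1Hazard F = mk⇔
  (λ hazard-free → (λ (α , h) → hazard-free false α h) , (λ (α , h) → hazard-free true α h))
  (λ { (no0 , no1) false α h → no0 (α , h) ; (no0 , no1) true α h → no1 (α , h) })

noHazard⇔noHazard-dual : (F : Circuit n) → (¬ HasHazard F ε) ⇔ (¬ HasHazard (dual F) (not ε))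
noHazard⇔noHazard-dual F = ¬-cong-⇔ (hasHazard⇔hasHazard-dual F)

no0Hazard⇔producesPrimeImplicates : (F : Circuit n) → (¬ HasHazard F false) ⇔ ProducesPrimeImplicates F
no0Hazard⇔producesPrimeImplicates F =
  ⇔-sym (producesPrimeImplicates⇔producesPrimeImplicants-dual F)
    ⇔-∘ (no1Hazard⇔producesPrimeImplicants (dual F) ⇔-∘ noHazard⇔noHazard-dual F)

corollary3 : ∀ {n} (F : Circuit n) →
  let f = evalB F in
    (HazardFree F ⇔ (¬ HasHazard F false × ¬ HasHazard (dual F) false))
  × (HazardFree F ⇔ (¬ HasHazard F true × ¬ HasHazard (dual F) true))
  × (HazardFree F ⇔
      ((∀ t → IsPrimeImplicant f t → ProducesTerm F t)
       × (∀ c → IsPrimeImplicate f c → ProducesClause F c)))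
corollary3 F =
    (⇔-id _ ×-⇔ noHazard⇔noHazard-dual F) ⇔-∘ no0Hazard×no1Hazard
  , (⇔-id _ ×-⇔ noHazard⇔noHazard-dual F) ⇔-∘ no1Hazard×no0Hazard
  , (no1Hazard⇔producesPrimeImplicants F ×-⇔ no0Hazard⇔producesPrimeImplicates F) ⇔-∘ no1Hazard×no0Hazard
  where
  no0Hazard×no1Hazard = hazardFree⇔no0Hazard×no1Hazard F
  no1Hazard×no0Hazard = ↔⇒⇔ (×-comm _ _) ⇔-∘ no0Hazard×no1Hazard
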